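{- Let $k\ge 1$ and let $W\in\mathcal W^2_{(3k+2)\times 5}$ with $e(W)\ge 4/3$ be such that, for every $h'<3k+2$, every sub-word of $W$ formed by $h'$ consecutive rows has excess at most $\hat e_{max}(h',5)$. Then $W$ does not contain a sub-word formed by $3$ consecutive rows whose excess equals $-2$.
   Context: A 2-dimensional binary word of dimensions $h\times w$ is an $h\times w$ matrix $W$ with entries in $\{\square,\blacksquare\}$ (filled cells $\blacksquare$, empty cells $\square$); $|W|_\blacksquare$ is its number of filled cells. Positions $(i,j),(i',j')$ are adjacent if $|i-i'|+|j-j'|=1$; the degree of a filled cell is the number of filled cells adjacent to it. $\mathcal W^2_{h\times w}$ is the set of $h\times w$ words in which every filled cell has degree at most $2$. The excess of an $a\times b$ word $V$ is $e(V)=|V|_\blacksquare-2ab/3$ (computed with the dimensions of $V$ itself). For positive integers $a\ge b$, $\hat e_{max}(a,b)$ equals $ab/3$ if $b=1$ or $a=b=2$; $ab/12$ if $a$ is even, $a\ge4$, $b=2$; $ab/12+1/2$ if $a$ is odd, $a\ge 3$, $b=2$; $2$ if $b=3$ or $a\equiv b\equiv 0\pmod 3$; $4/3$ if $b\ge 4$ and $a\equiv b\not\equiv 0\pmod 3$; $1$ if $b\ge4$, $ab\equiv 0 \pmod 3$ and $a\not\equiv b\pmod 3$; and $2/3$ otherwise. For $a<b$, $\hat e_{max}(a,b)=\hat e_{max}(b,a)$. -}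

module Defs where

open import Data.Bool using (Bool; true; false; if_then_else_; _∧_; _∨_; not)
open import Data.Nat as ℕ using (ℕ; zero; suc; _≤_; _<_; _%_; _≡ᵇ_; _≤ᵇ_)
open import Data.Nat.Properties using (≤-trans; +-monoʳ-<)
open import Data.Fin using (Fin; toℕ; fromℕ<)
open import Data.Fin.Properties using (toℕ<n)
open import Data.List using (List; map; allFin)
open import Data.Nat.ListAction using (sum)
open import Relation.Nullary using (yes; no)
open import Relation.Binary.PropositionalEquality using (_≡_)
open import Data.Integer using (ℤ; +_)
open import Data.Rational using (ℚ; _/_; _-_; _+_; 0ℚ)

-- A 2-dimensional binary word of dimensions h × w:
-- true = filled cell (■), false = empty cell (□).
Word : ℕ → ℕ → Set
Word h w = Fin h → Fin w → Bool

filled : ∀ {h w} → Word h w → ℕ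
filled {h} {w} W =
  sum (map (λ i → sum (map (λ j → if W i j then 1 else 0) (allFin w))) (allFin h))

-- value of W at natural-number coordinates; empty outside the word
at : ∀ {h w} → Word h w → ℕ → ℕ → Bool
at {h} {w} W i j with i ℕ.<? h | j ℕ.<? w
... | yes p | yes q = W (fromℕ< p) (fromℕ< q)
... | _ | _ = false

ind : Bool → ℕ
ind true = 1
ind false = 0

above : ∀ {h w} → Word h w → ℕ → ℕ → ℕ
above W zero j = 0
above W (suc i) j = ind (at W i j)

leftOf : ∀ {h w} → Word h w → ℕ → ℕ → ℕ
leftOf W i zero = 0
leftOf W i (suc j) = ind (at W i j)

degree : ∀ {h w} → Word h w → Fin h → Fin w → ℕ
degree W i j =
  let a = toℕ i ; b = toℕ j in
  above W a b ℕ.+ ind (at W (suc a) b) ℕ.+ leftOf W a b ℕ.+ ind (at W a (suc b))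

InW2 : ∀ {h w} → Word h w → Set
InW2 {h} {w} W = ∀ (i : Fin h) (j : Fin w) → W i j ≡ true → degree W i j ≤ 2

excess : ∀ {a b} → Word a b → ℚ
excess {a} {b} V = ((+ filled V) / 1) - ((+ (2 ℕ.* a ℕ.* b)) / 3)

rows : ∀ {h w} → Word h w → (i h' : ℕ) → i ℕ.+ h' ≤ h → Word h' w
rows W i h' p r c = W (fromℕ< (≤-trans (+-monoʳ-< i (toℕ<n r)) p)) c

-- ê_max(a,b) for a ≥ b ≥ 1, following the case list of the paper in order
emaxOrd : ℕ → ℕ → ℚ
emaxOrd a b =
  if (b ≡ᵇ 1) ∨ ((a ≡ᵇ 2) ∧ (b ≡ᵇ 2)) then (+ (a ℕ.* b)) / 3
  else if (b ≡ᵇ 2) ∧ (a % 2 ≡ᵇ 0) then (+ (a ℕ.* b)) / 12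
  else if (b ≡ᵇ 2) then ((+ (a ℕ.* b)) / 12) + ((+ 1) / 2)
  else if (b ≡ᵇ 3) ∨ ((a % 3 ≡ᵇ 0) ∧ (b % 3 ≡ᵇ 0)) then (+ 2) / 1
  else if (4 ≤ᵇ b) ∧ (a % 3 ≡ᵇ b % 3) ∧ not (a % 3 ≡ᵇ 0) then (+ 4) / 3
  else if (4 ≤ᵇ b) ∧ ((a ℕ.* b) % 3 ≡ᵇ 0) ∧ not (a % 3 ≡ᵇ b % 3) then (+ 1) / 1
  else (+ 2) / 3

emax : ℕ → ℕ → ℚ
emax a b = if b ≤ᵇ a then emaxOrd a b else emaxOrd b a

{-# OPTIONS --safe #-}

-- Measure excess in thirds: for h consecutive rows, 3e = 3·(filled cells) − 10h is an integer,
-- additive when sub-words are stacked, and the hypothesis bounds it by slack h = 3·ê_max(h,5).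
-- Cutting W (3e ≥ 4) at a block of three rows with 3e = −6 leaves parts of heights i and b above
-- and below it with i + b ≡ 2 (mod 3) and slack i + slack b ≥ 10, which the values of ê_max allow
-- only for (i, b) = (3, ≡ 2), (≡ 2, 3) or (1, 1).  In the first two cases the three outer rows next
-- to the block carry 12 cells, which in 𝒲² empties the adjacent row of the block, and the count
-- falls short; in the last case the first and last rows are full, which leaves fewer than 8 cells
-- for the block.  These three facts about strips of width 5 are checked exhaustively.

module Submission where

open import Defs
open import Data.Bool using (Bool; true; false; T; not; _∧_; _∨_; if_then_else_)
open import Data.Bool.Properties using (T-∧)
open import Data.Empty using (⊥)
open import Data.Fin using (Fin; toℕ; fromℕ<)
open import Data.Fin.Patterns using (0F; 1F; 2F; 3F; 4F)
import Data.Fin.Properties as FinP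
open import Data.Integer as ℤ using (ℤ; +_; -[1+_]; +≤+; +<+; -<+)
import Data.Integer.Properties as ℤP
import Data.Integer.Tactic.RingSolver as ℤ-Solver
open import Data.List using (List; []; _∷_; _++_; map; allFin; tabulate)
open import Data.List.Properties using (map-++; map-cong; map-tabulate)
open import Data.Nat as ℕ using (ℕ; zero; suc; _+_; _*_; _%_; _≤_; _<_; _≤ᵇ_; _≤?_; _<?_; _≟_; z≤n; s≤s)
import Data.Nat.Properties as ℕP
open import Data.Nat.DivMod using (_divMod_; result; [m+kn]%n≡m%n)
open import Data.Nat.ListAction using (sum)
open import Data.Nat.ListAction.Properties using (sum-++)
import Data.Nat.Tactic.RingSolver as ℕ-Solver
open import Data.Product using (Σ; _×_; _,_; proj₁; proj₂)
open import Data.Rational as Q using (_/_; toℚᵘ)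
import Data.Rational.Properties as QP
open import Data.Rational.Unnormalised as U using (mkℚᵘ)
import Data.Rational.Unnormalised.Properties as UP
open import Data.Sum using (_⊎_; inj₁; inj₂)
open import Data.Unit using (tt)
open import Data.Vec using (Vec; []; _∷_; lookup; replicate)
import Data.Vec as Vec
open import Function using (id; _∘_)
open import Function.Bundles using (Equivalence)
open import Relation.Nullary using (Dec; ¬_; yes; no)
open import Relation.Nullary.Decidable using (map′; _×-dec_; _→-dec_; from-yes; T?)
open import Relation.Nullary.Negation using (contradiction)
open import Relation.Binary.PropositionalEquality

-- Excess in thirds

toℚᵘ-excess : ∀ F M → toℚᵘ ((+ F) / 1 Q.- (+ M) / 3) U.≃ mkℚᵘ (+ F) 0 U.- mkℚᵘ (+ M) 2
toℚᵘ-excess F M = UP.≃-trans (QP.toℚᵘ-homo-+ ((+ F) / 1) (Q.- ((+ M) / 3)))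
  (UP.+-cong (QP.toℚᵘ-fromℚᵘ (mkℚᵘ (+ F) 0))
    (UP.≃-trans (QP.toℚᵘ-homo‿- ((+ M) / 3)) (UP.-‿cong (QP.toℚᵘ-fromℚᵘ (mkℚᵘ (+ M) 2)))))

private
  thirds-numerator : ∀ f m → f ℤ.* + 3 ℤ.+ ℤ.- m ℤ.* + 1 ≡ + 3 ℤ.* f ℤ.- m
  thirds-numerator = ℤ-Solver.solve-∀

excess≤⇒ : ∀ F M c → (+ F) / 1 Q.- (+ M) / 3 Q.≤ c / 3 → + 3 ℤ.* + F ℤ.- + M ℤ.≤ c
excess≤⇒ F M c le = subst (ℤ._≤ c) (thirds-numerator (+ F) (+ M))
  (ℤP.*-cancelʳ-≤-pos _ c (+ 3) (UP.drop-*≤*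
    (UP.≤-respʳ-≃ (QP.toℚᵘ-fromℚᵘ (mkℚᵘ c 2)) (UP.≤-respˡ-≃ (toℚᵘ-excess F M) (QP.toℚᵘ-mono-≤ le)))))

≤excess⇒ : ∀ F M c → c / 3 Q.≤ (+ F) / 1 Q.- (+ M) / 3 → c ℤ.≤ + 3 ℤ.* + F ℤ.- + M
≤excess⇒ F M c le = subst (c ℤ.≤_) (thirds-numerator (+ F) (+ M))
  (ℤP.*-cancelʳ-≤-pos c _ (+ 3) (UP.drop-*≤*
    (UP.≤-respˡ-≃ (QP.toℚᵘ-fromℚᵘ (mkℚᵘ c 2)) (UP.≤-respʳ-≃ (toℚᵘ-excess F M) (QP.toℚᵘ-mono-≤ le)))))

slack : ℕ → ℕ
slack 0 = 0
slack 1 = 5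
slack 2 = 4
slack 3 = 6
slack 4 = 2
slack 5 = 4
slack 6 = 3
slack (suc (suc (suc (suc (suc (suc (suc h))))))) = slack (suc (suc (suc (suc h))))

emax-width5 : ∀ h → emax (suc h) 5 ≡ (+ slack (suc h)) / 3
emax-width5 0 = refl
emax-width5 1 = refl
emax-width5 2 = refl
emax-width5 3 = refl
emax-width5 4 = refl
emax-width5 5 = refl
emax-width5 6 = refl
-- Accepted as is: the heights 8 + h and 5 + h are both at least 5 and agree mod 3, so the two sides
-- compute to the same term.
emax-width5 (suc (suc (suc (suc (suc (suc (suc h))))))) = emax-width5 (suc (suc (suc (suc h))))

slack-2+3m : ∀ m → slack (2 + m * 3) ≡ 4
slack-2+3m zero = refl
slack-2+3m (suc zero) = refl
slack-2+3m (suc (suc m)) = slack-2+3m (suc m)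

slack-4+3m : ∀ m → slack (4 + m * 3) ≡ 2
slack-4+3m zero = refl
slack-4+3m (suc m) = slack-4+3m m

slack-6+3m : ∀ m → slack (6 + m * 3) ≡ 3
slack-6+3m zero = refl
slack-6+3m (suc m) = slack-6+3m m

-- Rows of width 5 and the degree condition

Row : Set
Row = Vec Bool 5

empty : Row
empty = replicate 5 false

rowCount : (Fin 5 → Bool) → ℕ
rowCount f = sum (map (λ c → if f c then 1 else 0) (allFin 5))

count : Row → ℕ
count r = rowCount (lookup r)

weight : List Row → ℕ
weight rs = sum (map count rs)

-- Neighbours are summed in the order of Defs.degree, so the degree bound of a word transfers as is.
okCell : (cell up down left right : Bool) → Bool
okCell s u d l r = not s ∨ (ind u + ind d + ind l + ind r ≤ᵇ 2)

admissible : Row → Row → Row → Bool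
admissible (u₀ ∷ u₁ ∷ u₂ ∷ u₃ ∷ u₄ ∷ []) (m₀ ∷ m₁ ∷ m₂ ∷ m₃ ∷ m₄ ∷ []) (d₀ ∷ d₁ ∷ d₂ ∷ d₃ ∷ d₄ ∷ []) =
  okCell m₀ u₀ d₀ false m₁ ∧ (okCell m₁ u₁ d₁ m₀ m₂ ∧ (okCell m₂ u₂ d₂ m₁ m₃ ∧
  (okCell m₃ u₃ d₃ m₂ m₄ ∧ okCell m₄ u₄ d₄ m₃ false)))

admissibleBelow : Row → List Row → Bool
admissibleBelow u [] = true
admissibleBelow u (m ∷ []) = admissible u m empty
admissibleBelow u (m ∷ d ∷ rs) = admissible u m d ∧ admissibleBelow m (d ∷ rs)

-- The stack of rows, with empty space above and below, lies in 𝒲².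
strip : List Row → Bool
strip = admissibleBelow empty

T-∧⁻ : ∀ {x y} → T (x ∧ y) → T x × T y
T-∧⁻ = Equivalence.to T-∧

T-∧⁺ : ∀ {x y} → T x → T y → T (x ∧ y)
T-∧⁺ p q = Equivalence.from T-∧ (p , q)

T-∧-map : ∀ {x y x′ y′} → (T x → T x′) → (T y → T y′) → T (x ∧ y) → T (x′ ∧ y′)
T-∧-map f g xy = let p , q = T-∧⁻ xy in T-∧⁺ (f p) (g q)

okCell-dropUp : ∀ s u d l r → T (okCell s u d l r) → T (okCell s false d l r)
okCell-dropUp false _ _ _ _ _ = tt
okCell-dropUp true u d l r ok = ℕP.≤⇒≤ᵇ (ℕP.≤-trans
  (ℕP.+-monoˡ-≤ (ind r) (ℕP.+-monoˡ-≤ (ind l) (ℕP.+-monoˡ-≤ (ind d) z≤n)))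
  (ℕP.≤ᵇ⇒≤ (ind u + ind d + ind l + ind r) 2 ok))

okCell-flip : ∀ s u d l r → T (okCell s u d l r) → T (okCell s d u l r)
okCell-flip s u d l r = subst (λ k → T (not s ∨ (k + ind l + ind r ≤ᵇ 2))) (ℕP.+-comm (ind u) (ind d))

admissible-dropAbove : ∀ u m d → T (admissible u m d) → T (admissible empty m d)
admissible-dropAbove (u₀ ∷ u₁ ∷ u₂ ∷ u₃ ∷ u₄ ∷ []) (m₀ ∷ m₁ ∷ m₂ ∷ m₃ ∷ m₄ ∷ []) (d₀ ∷ d₁ ∷ d₂ ∷ d₃ ∷ d₄ ∷ []) =
  T-∧-map (okCell-dropUp m₀ u₀ d₀ false m₁) (T-∧-map (okCell-dropUp m₁ u₁ d₁ m₀ m₂)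
  (T-∧-map (okCell-dropUp m₂ u₂ d₂ m₁ m₃) (T-∧-map (okCell-dropUp m₃ u₃ d₃ m₂ m₄)
  (okCell-dropUp m₄ u₄ d₄ m₃ false))))

admissible-flip : ∀ u m d → T (admissible u m d) → T (admissible d m u)
admissible-flip (u₀ ∷ u₁ ∷ u₂ ∷ u₃ ∷ u₄ ∷ []) (m₀ ∷ m₁ ∷ m₂ ∷ m₃ ∷ m₄ ∷ []) (d₀ ∷ d₁ ∷ d₂ ∷ d₃ ∷ d₄ ∷ []) =
  T-∧-map (okCell-flip m₀ u₀ d₀ false m₁) (T-∧-map (okCell-flip m₁ u₁ d₁ m₀ m₂)
  (T-∧-map (okCell-flip m₂ u₂ d₂ m₁ m₃) (T-∧-map (okCell-flip m₃ u₃ d₃ m₂ m₄)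
  (okCell-flip m₄ u₄ d₄ m₃ false))))

admissible-dropBelow : ∀ u m d → T (admissible u m d) → T (admissible u m empty)
admissible-dropBelow u m d = admissible-flip empty m u ∘ admissible-dropAbove d m u ∘ admissible-flip u m d

admissibleBelow-dropAbove : ∀ u rs → T (admissibleBelow u rs) → T (strip rs)
admissibleBelow-dropAbove u [] _ = tt
admissibleBelow-dropAbove u (m ∷ []) = admissible-dropAbove u m empty
admissibleBelow-dropAbove u (m ∷ d ∷ rs) = T-∧-map (admissible-dropAbove u m d) id

strip-reverse : ∀ a b c d → T (strip (a ∷ b ∷ c ∷ d ∷ [])) → T (strip (d ∷ c ∷ b ∷ a ∷ []))
strip-reverse a b c d s =
  let ab , s₁ = T-∧⁻ s ; abc , s₂ = T-∧⁻ s₁ ; bcd , cd = T-∧⁻ s₂ in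
  T-∧⁺ (admissible-flip c d empty cd) (T-∧⁺ (admissible-flip b c d bcd)
    (T-∧⁺ (admissible-flip a b c abc) (admissible-flip empty a b ab)))

∀-Bool? : {P : Bool → Set} → (∀ b → Dec (P b)) → Dec (∀ b → P b)
∀-Bool? P? = map′ (λ { (t , f) true → t ; (t , f) false → f }) (λ h → h true , h false) (P? true ×-dec P? false)

∀-Row? : {P : Row → Set} → (∀ r → Dec (P r)) → Dec (∀ r → P r)
∀-Row? P? = map′ (λ h → λ { (a ∷ b ∷ c ∷ d ∷ e ∷ []) → h a b c d e })
                 (λ h a b c d e → h (a ∷ b ∷ c ∷ d ∷ e ∷ []))
  (∀-Bool? λ a → ∀-Bool? λ b → ∀-Bool? λ c → ∀-Bool? λ d → ∀-Bool? λ e → P? (a ∷ b ∷ c ∷ d ∷ e ∷ []))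

dense-triple-then-empty : ∀ a b c d → T (strip (a ∷ b ∷ c ∷ d ∷ [])) →
                          12 ≤ weight (a ∷ b ∷ c ∷ []) → count d ≡ 0
dense-triple-then-empty a b c d s dense =
  let ab , s₁ = T-∧⁻ s ; abc , cd = T-∧⁻ s₁ in search a b ab c abc dense d cd
  where
  -- The constraints are interleaved with the quantifiers so that the exhaustive search is pruned early.
  search : ∀ a b → T (admissible empty a b) → ∀ c → T (admissible a b c) → 12 ≤ weight (a ∷ b ∷ c ∷ []) →
           ∀ d → T (admissible b c d ∧ admissible c d empty) → count d ≡ 0
  search = from-yes (∀-Row? λ a → ∀-Row? λ b → T? (admissible empty a b) →-dec ∀-Row? λ c →
    T? (admissible a b c) →-dec (12 ≤? weight (a ∷ b ∷ c ∷ [])) →-dec ∀-Row? λ d →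
    T? (admissible b c d ∧ admissible c d empty) →-dec (count d ≟ 0))

empty-then-dense-triple : ∀ a b c d → T (strip (a ∷ b ∷ c ∷ d ∷ [])) →
                          12 ≤ weight (b ∷ c ∷ d ∷ []) → count a ≡ 0
empty-then-dense-triple a b c d s dense =
  dense-triple-then-empty d c b a (strip-reverse a b c d s)
    (subst (12 ≤_) (reverse3 (count b) (count c) (count d)) dense)
  where
  reverse3 : ∀ x y z → x + (y + (z + 0)) ≡ z + (y + (x + 0))
  reverse3 = ℕ-Solver.solve-∀

between-full-rows : ∀ a b c d e → T (strip (a ∷ b ∷ c ∷ d ∷ e ∷ [])) → 5 ≤ count a → 5 ≤ count e →
                    weight (b ∷ c ∷ d ∷ []) < 8
between-full-rows a b c d e s a-full e-full =
  let ab , s₁ = T-∧⁻ s ; abc , bcde = T-∧⁻ s₁ in search a a-full e e-full b ab c abc d bcde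
  where
  search : ∀ a → 5 ≤ count a → ∀ e → 5 ≤ count e → ∀ b → T (admissible empty a b) → ∀ c → T (admissible a b c) →
           ∀ d → T (admissible b c d ∧ (admissible c d e ∧ admissible d e empty)) → weight (b ∷ c ∷ d ∷ []) < 8
  search = from-yes (∀-Row? λ a → (5 ≤? count a) →-dec ∀-Row? λ e → (5 ≤? count e) →-dec
    ∀-Row? λ b → T? (admissible empty a b) →-dec ∀-Row? λ c → T? (admissible a b c) →-dec
    ∀-Row? λ d → T? (admissible b c d ∧ (admissible c d e ∧ admissible d e empty)) →-dec
    (weight (b ∷ c ∷ d ∷ []) <? 8))

-- Words of width 5 as stacks of rows

module _ {n : ℕ} (W : Word n 5) where

  rowOf : ℕ → Row
  rowOf r = Vec.tabulate (λ c → at W r (toℕ c))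

  rowAbove : ℕ → Row
  rowAbove zero = empty
  rowAbove (suc r) = rowOf r

  window : ℕ → ℕ → List Row
  window j zero = []
  window j (suc h) = rowOf j ∷ window (suc j) h

  cells : ℕ → ℕ → ℕ
  cells j h = weight (window j h)

  -- 3·e of the sub-word formed by the rows j, …, j + h − 1
  thirds : ℕ → ℕ → ℤ
  thirds j h = + 3 ℤ.* + cells j h ℤ.- + (2 * h * 5)

  at-toℕ : ∀ i c → at W (toℕ i) (toℕ c) ≡ W i c
  at-toℕ i c with toℕ i ℕ.<? n | toℕ c ℕ.<? 5
  ... | yes p | yes q = cong₂ W (FinP.fromℕ<-toℕ i p) (FinP.fromℕ<-toℕ c q)
  ... | no ¬p | _     = contradiction (FinP.toℕ<n i) ¬p
  ... | yes _ | no ¬q = contradiction (FinP.toℕ<n c) ¬q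

  at-beyond : ∀ r → at W r 5 ≡ false
  at-beyond r with r ℕ.<? n
  ... | yes _ = refl
  ... | no _  = refl

  count-rowOf : ∀ i → rowCount (W i) ≡ count (rowOf (toℕ i))
  count-rowOf i = cong sum (map-cong (λ c → cong (λ b → if b then 1 else 0) (sym (at-toℕ i c))) (allFin 5))

  sum-tabulate-rows : ∀ j h (f : Fin h → ℕ) → (∀ r → f r ≡ count (rowOf (j + toℕ r))) →
                      sum (tabulate f) ≡ cells j h
  sum-tabulate-rows j zero f _ = refl
  sum-tabulate-rows j (suc h) f f≡ = cong₂ _+_
    (trans (f≡ Fin.zero) (cong (count ∘ rowOf) (ℕP.+-identityʳ j)))
    (sum-tabulate-rows (suc j) h (f ∘ Fin.suc) λ r →
      trans (f≡ (Fin.suc r)) (cong (count ∘ rowOf) (ℕP.+-suc j (toℕ r))))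

  filled-rows : ∀ j h (p : j + h ≤ n) → filled (rows W j h p) ≡ cells j h
  filled-rows j h p = trans (cong sum (map-tabulate id (rowCount ∘ rows W j h p)))
    (sum-tabulate-rows j h _ λ r → trans (count-rowOf (fromℕ< _)) (cong (count ∘ rowOf) (FinP.toℕ-fromℕ< _)))

  filled-word : filled W ≡ cells 0 n
  filled-word = trans (cong sum (map-tabulate id (rowCount ∘ W))) (sum-tabulate-rows 0 n _ count-rowOf)

  window-++ : ∀ j a c → window j (a + c) ≡ window j a ++ window (j + a) c
  window-++ j zero c = cong (λ i → window i c) (sym (ℕP.+-identityʳ j))
  window-++ j (suc a) c = cong (rowOf j ∷_)
    (trans (window-++ (suc j) a c) (cong (λ i → window (suc j) a ++ window i c) (sym (ℕP.+-suc j a))))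

  cells-split : ∀ j a c → cells j (a + c) ≡ cells j a + cells (j + a) c
  cells-split j a c = begin
    sum (map count (window j (a + c)))                     ≡⟨ cong (sum ∘ map count) (window-++ j a c) ⟩
    sum (map count (window j a ++ window (j + a) c))       ≡⟨ cong sum (map-++ count (window j a) _) ⟩
    sum (map count (window j a) ++ map count (window (j + a) c)) ≡⟨ sum-++ (map count (window j a)) _ ⟩
    cells j a + cells (j + a) c                            ∎
    where open ≡-Reasoning

  thirds-split : ∀ j a c → thirds j (a + c) ≡ thirds j a ℤ.+ thirds (j + a) c
  thirds-split j a c = trans
    (cong₂ (λ x y → + 3 ℤ.* + x ℤ.- + y) (cells-split j a c) (distrib a c))
    (regroup (+ cells j a) (+ cells (j + a) c) (+ (2 * a * 5)) (+ (2 * c * 5)))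
    where
    distrib : ∀ a c → 2 * (a + c) * 5 ≡ 2 * a * 5 + 2 * c * 5
    distrib = ℕ-Solver.solve-∀
    regroup : ∀ x y p q → + 3 ℤ.* (x ℤ.+ y) ℤ.- (p ℤ.+ q) ≡ (+ 3 ℤ.* x ℤ.- p) ℤ.+ (+ 3 ℤ.* y ℤ.- q)
    regroup = ℤ-Solver.solve-∀

  thirds-≤ : ∀ j h {x} → cells j h ≤ x → thirds j h ℤ.≤ + 3 ℤ.* + x ℤ.- + (2 * h * 5)
  thirds-≤ j h le = ℤP.+-monoˡ-≤ (ℤ.- + (2 * h * 5)) (ℤP.*-monoˡ-≤-nonNeg (+ 3) (+≤+ le))

  thirds-rows≤ : ∀ j h (p : j + h ≤ n) c → excess (rows W j h p) Q.≤ c / 3 → thirds j h ℤ.≤ c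
  thirds-rows≤ j h p c le =
    subst (λ F → + 3 ℤ.* + F ℤ.- + (2 * h * 5) ℤ.≤ c) (filled-rows j h p)
      (excess≤⇒ (filled (rows W j h p)) (2 * h * 5) c le)

  thirds-word≥ : ∀ c → c / 3 Q.≤ excess W → c ℤ.≤ thirds 0 n
  thirds-word≥ c le =
    subst (λ F → c ℤ.≤ + 3 ℤ.* + F ℤ.- + (2 * n * 5)) filled-word (≤excess⇒ (filled W) (2 * n * 5) c le)

  module _ (W∈𝒲² : InW2 W) where

    admissible-rowOf : ∀ r → r < n → T (admissible (rowAbove r) (rowOf r) (rowOf (suc r)))
    admissible-rowOf r r<n = subst (λ x → T (admissible (rowAbove x) (rowOf x) (rowOf (suc x))))
      (FinP.toℕ-fromℕ< r<n) (cells-ok (toℕ i) λ c → subst (λ s → T (not s ∨ (degree W i c ≤ᵇ 2)))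
        (sym (at-toℕ i c)) (cell-ok c))
      where
      i = fromℕ< r<n
      cell-ok : ∀ c → T (not (W i c) ∨ (degree W i c ≤ᵇ 2))
      cell-ok c with W i c in filled
      ... | false = tt
      ... | true  = ℕP.≤⇒≤ᵇ (W∈𝒲² i c filled)
      OkAt : ℕ → ℕ → Bool → Set
      OkAt x k right = T (not (at W x k) ∨ (above W x k + ind (at W (suc x) k) + leftOf W x k + ind right ≤ᵇ 2))
      -- Defs.degree reads the right neighbour of column 4 in column 5, outside the word.
      cells-ok : ∀ x → (∀ c → OkAt x (toℕ c) (at W x (suc (toℕ c)))) →
                 T (admissible (rowAbove x) (rowOf x) (rowOf (suc x)))
      cells-ok zero ok = T-∧⁺ (ok 0F) (T-∧⁺ (ok 1F) (T-∧⁺ (ok 2F) (T-∧⁺ (ok 3F)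
        (subst (OkAt zero 4) (at-beyond zero) (ok 4F)))))
      cells-ok (suc x) ok = T-∧⁺ (ok 0F) (T-∧⁺ (ok 1F) (T-∧⁺ (ok 2F) (T-∧⁺ (ok 3F)
        (subst (OkAt (suc x) 4) (at-beyond (suc x)) (ok 4F)))))

    strip-window : ∀ j h → j + h ≤ n → T (strip (window j h))
    strip-window j zero _ = tt
    strip-window j (suc h) le = admissibleBelow-dropAbove (rowAbove j) (window j (suc h)) (below j h le)
      where
      below : ∀ j h → j + suc h ≤ n → T (admissibleBelow (rowAbove j) (window j (suc h)))
      below j zero le = admissible-dropBelow (rowAbove j) (rowOf j) (rowOf (suc j))
        (admissible-rowOf j (ℕP.<-≤-trans (ℕP.m<m+n j (s≤s z≤n)) le))
      below j (suc h) le = T-∧⁺ (admissible-rowOf j (ℕP.<-≤-trans (ℕP.m<m+n j (s≤s z≤n)) le))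
        (below (suc j) h (subst (_≤ n) (ℕP.+-suc j (suc h)) le))

-- Splitting W at a deficient block

data TightSplit : ℕ → ℕ → Set where
  three-above : ∀ m → TightSplit 3 (2 + m * 3)
  three-below : ∀ m → TightSplit (2 + m * 3) 3
  one-each    : TightSplit 1 1

-- ê_max(i,5) − 2 + ê_max(b,5) < 4/3, scaled by 3
SlackTooSmall : ℕ → ℕ → Set
SlackTooSmall i b = + slack i ℤ.+ -[1+ 5 ] ℤ.+ + slack b ℤ.< + 4

residues-mod3 : ∀ r s x y → (r + x * 3 + (s + y * 3)) % 3 ≡ 2 → (r + s) % 3 ≡ 2
residues-mod3 r s x y ≡2 =
  trans (sym ([m+kn]%n≡m%n (r + s) (x + y) 3)) (trans (cong (_% 3) (sym (regroup r s x y))) ≡2)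
  where
  regroup : ∀ r s x y → r + x * 3 + (s + y * 3) ≡ r + s + (x + y) * 3
  regroup = ℕ-Solver.solve-∀

+1<+4 : + 1 ℤ.< + 4
+1<+4 = +<+ (s≤s (s≤s z≤n))

too-small : ∀ i b {s t} → slack i ≡ s → slack b ≡ t → + s ℤ.+ -[1+ 5 ] ℤ.+ + t ℤ.< + 4 → SlackTooSmall i b
too-small _ _ refl refl short = short

classify-split : ∀ i b → (i + b) % 3 ≡ 2 → TightSplit i b ⊎ SlackTooSmall i b
classify-split i b res with i divMod 3 | b divMod 3
... | result zero 0F refl | result y 2F refl =
  inj₂ (too-small 0 (2 + y * 3) refl (slack-2+3m y) -<+)
... | result (suc zero) 0F refl | result y 2F refl = inj₁ (three-above y)
... | result (suc (suc x)) 0F refl | result y 2F refl =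
  inj₂ (too-small (6 + x * 3) (2 + y * 3) (slack-6+3m x) (slack-2+3m y) +1<+4)
... | result zero 1F refl | result zero 1F refl = inj₁ one-each
... | result zero 1F refl | result (suc y) 1F refl =
  inj₂ (too-small 1 (4 + y * 3) refl (slack-4+3m y) +1<+4)
... | result (suc x) 1F refl | result zero 1F refl =
  inj₂ (too-small (4 + x * 3) 1 (slack-4+3m x) refl +1<+4)
... | result (suc x) 1F refl | result (suc y) 1F refl =
  inj₂ (too-small (4 + x * 3) (4 + y * 3) (slack-4+3m x) (slack-4+3m y) -<+)
... | result x 2F refl | result zero 0F refl =
  inj₂ (too-small (2 + x * 3) 0 (slack-2+3m x) refl -<+)
... | result x 2F refl | result (suc zero) 0F refl = inj₁ (three-below x)
... | result x 2F refl | result (suc (suc y)) 0F refl =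
  inj₂ (too-small (2 + x * 3) (6 + y * 3) (slack-2+3m x) (slack-6+3m y) +1<+4)
... | result x 0F refl | result y 0F refl = contradiction (residues-mod3 0 0 x y res) λ ()
... | result x 0F refl | result y 1F refl = contradiction (residues-mod3 0 1 x y res) λ ()
... | result x 1F refl | result y 0F refl = contradiction (residues-mod3 1 0 x y res) λ ()
... | result x 1F refl | result y 2F refl = contradiction (residues-mod3 1 2 x y res) λ ()
... | result x 2F refl | result y 1F refl = contradiction (residues-mod3 2 1 x y res) λ ()
... | result x 2F refl | result y 2F refl = contradiction (residues-mod3 2 2 x y res) λ ()

module Counting {n : ℕ} (W : Word n 5) (W∈𝒲² : InW2 W)
  (window-bound : ∀ j h → h < n → j + h ≤ n → thirds W j h ℤ.≤ + slack h)
  (total : + 4 ℤ.≤ thirds W 0 n) where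

  infeasible : ∀ a c d {x y z} → a + c + d ≡ n →
               thirds W 0 a ℤ.≤ x → thirds W a c ℤ.≤ y → thirds W (a + c) d ℤ.≤ z → x ℤ.+ y ℤ.+ z ℤ.< + 4 → ⊥
  infeasible a c d {x} {y} {z} eq ta tc td short = ℤP.<-irrefl refl (begin-strict
    + 4                                           ≤⟨ total ⟩
    thirds W 0 n                                  ≡⟨ cong (thirds W 0) (sym eq) ⟩
    thirds W 0 (a + c + d)                        ≡⟨ thirds-split W 0 (a + c) d ⟩
    thirds W 0 (a + c) ℤ.+ rest                   ≡⟨ cong (ℤ._+ rest) (thirds-split W 0 a c) ⟩
    thirds W 0 a ℤ.+ thirds W a c ℤ.+ rest        ≤⟨ ℤP.+-mono-≤ (ℤP.+-mono-≤ ta tc) td ⟩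
    x ℤ.+ y ℤ.+ z                                 <⟨ short ⟩
    + 4                                           ∎)
    where
    open ℤP.≤-Reasoning
    rest = thirds W (a + c) d

  prefix-bound : ∀ a d {s} → a + d ≡ n → 0 < d → slack a ≡ s → thirds W 0 a ℤ.≤ + s
  prefix-bound a d eq d>0 refl =
    window-bound 0 a (subst (a <_) eq (ℕP.m<m+n a d>0)) (subst (a ≤_) eq (ℕP.m≤m+n a d))

  suffix-bound : ∀ a d {s} → a + d ≡ n → 0 < a → slack d ≡ s → thirds W a d ℤ.≤ + s
  suffix-bound a d eq a>0 refl = window-bound a d (subst (d <_) eq (ℕP.m<n+m d a>0)) (ℕP.≤-reflexive eq)

  three-above-impossible : ∀ m → 3 + 3 + (2 + m * 3) ≡ n → thirds W 3 3 ℤ.≤ -[1+ 5 ] → ⊥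
  three-above-impossible m eq deficient =
    infeasible 3 1 (4 + m * 3) eq (prefix-bound 3 _ eq (s≤s z≤n) refl)
      (thirds-≤ W 3 1 (ℕP.≤-reflexive (cong (_+ 0) empty-row)))
      (suffix-bound 4 _ eq (s≤s z≤n) (slack-4+3m m)) -<+
    where
    dense : 12 ≤ cells W 0 3
    dense = ℕP.≮⇒≥ λ sparse → infeasible 3 3 (2 + m * 3) eq (thirds-≤ W 0 3 (ℕP.≤-pred sparse)) deficient
      (suffix-bound 6 _ eq (s≤s z≤n) (slack-2+3m m)) +1<+4
    empty-row : count (rowOf W 3) ≡ 0
    empty-row = dense-triple-then-empty (rowOf W 0) (rowOf W 1) (rowOf W 2) (rowOf W 3)
      (strip-window W W∈𝒲² 0 4 (subst (4 ≤_) eq (ℕP.m≤m+n 4 (4 + m * 3)))) dense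

  three-below-impossible : ∀ m → 2 + m * 3 + 3 + 3 ≡ n → thirds W (2 + m * 3) 3 ℤ.≤ -[1+ 5 ] → ⊥
  three-below-impossible m eq deficient =
    infeasible j 1 3 eq′
      (prefix-bound j 4 (trans (sym (ℕP.+-assoc j 1 3)) eq′) (s≤s z≤n)
        (trans (cong slack (ℕP.+-comm i 2)) (slack-4+3m m)))
      (thirds-≤ W j 1 (ℕP.≤-reflexive (cong (_+ 0) empty-row)))
      (suffix-bound (j + 1) 3 eq′ (s≤s z≤n) refl) -<+
    where
    i = 2 + m * 3
    j = i + 2
    eq′ : j + 1 + 3 ≡ n
    eq′ = trans (cong (_+ 3) (ℕP.+-assoc i 2 1)) eq
    dense : 12 ≤ cells W (i + 3) 3
    dense = ℕP.≮⇒≥ λ sparse → infeasible i 3 3 eq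
      (prefix-bound i 6 (trans (sym (ℕP.+-assoc i 3 3)) eq) (s≤s z≤n) (slack-2+3m m)) deficient
      (thirds-≤ W (i + 3) 3 (ℕP.≤-pred sparse)) +1<+4
    empty-row : count (rowOf W j) ≡ 0
    empty-row = empty-then-dense-triple (rowOf W j) (rowOf W (1 + j)) (rowOf W (2 + j)) (rowOf W (3 + j))
      (strip-window W W∈𝒲² j 4 (ℕP.≤-reflexive (trans (ℕP.+-assoc i 2 4) (trans (sym (ℕP.+-assoc i 3 3)) eq))))
      (subst (λ x → 12 ≤ cells W x 3) (ℕP.+-suc i 2) dense)

  one-each-impossible : 1 + 3 + 1 ≡ n → thirds W 1 3 ℤ.≤ -[1+ 5 ] → ⊥
  one-each-impossible eq deficient =
    ℕP.<⇒≱ (between-full-rows (rowOf W 0) (rowOf W 1) (rowOf W 2) (rowOf W 3) (rowOf W 4)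
      (strip-window W W∈𝒲² 0 5 (ℕP.≤-reflexive eq)) first-full last-full) dense
    where
    first : thirds W 0 1 ℤ.≤ + 5
    first = prefix-bound 1 4 eq (s≤s z≤n) refl
    last : thirds W 4 1 ℤ.≤ + 5
    last = suffix-bound 4 1 eq (s≤s z≤n) refl
    first-full : 5 ≤ count (rowOf W 0)
    first-full = ℕP.≮⇒≥ λ lt → infeasible 1 3 1 eq
      (thirds-≤ W 0 1 (ℕP.+-monoˡ-≤ 0 (ℕP.≤-pred lt))) deficient last +1<+4
    last-full : 5 ≤ count (rowOf W 4)
    last-full = ℕP.≮⇒≥ λ lt → infeasible 1 3 1 eq
      first deficient (thirds-≤ W 4 1 (ℕP.+-monoˡ-≤ 0 (ℕP.≤-pred lt))) +1<+4
    dense : 8 ≤ cells W 1 3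
    dense = ℕP.≮⇒≥ λ sparse → infeasible 1 3 1 eq
      first (thirds-≤ W 1 3 (ℕP.≤-pred sparse)) last +1<+4

  no-deficient-block : ∀ i b → i + 3 + b ≡ n → (i + b) % 3 ≡ 2 → thirds W i 3 ℤ.≤ -[1+ 5 ] → ⊥
  no-deficient-block i b eq res deficient with classify-split i b res
  ... | inj₁ (three-above m) = three-above-impossible m eq deficient
  ... | inj₁ (three-below m) = three-below-impossible m eq deficient
  ... | inj₁ one-each        = one-each-impossible eq deficient
  ... | inj₂ short           = infeasible i 3 b eq
    (prefix-bound i (3 + b) (trans (sym (ℕP.+-assoc i 3 b)) eq) (s≤s z≤n) refl) deficient
    (suffix-bound (i + 3) b eq (ℕP.<-≤-trans (s≤s z≤n) (ℕP.m≤n+m 3 i)) refl) short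

window-bounds : ∀ {n} (W : Word n 5) →
  ((i h′ : ℕ) → 1 ≤ h′ → h′ < n → (p : i + h′ ≤ n) → excess (rows W i h′ p) Q.≤ emax h′ 5) →
  ∀ j h → h < n → j + h ≤ n → thirds W j h ℤ.≤ + slack h
window-bounds W bounded j zero _ _ = +≤+ z≤n
window-bounds W bounded j (suc h) h<n p = thirds-rows≤ W j (suc h) p (+ slack (suc h))
  (subst (excess (rows W j (suc h) p) Q.≤_) (emax-width5 h) (bounded j (suc h) (s≤s z≤n) h<n p))

residue-of-split : ∀ i b k → i + 3 + b ≡ 3 * k + 2 → (i + b) % 3 ≡ 2
residue-of-split i b k eq = begin
  (i + b) % 3             ≡⟨ sym ([m+kn]%n≡m%n (i + b) 1 3) ⟩
  (i + b + 1 * 3) % 3     ≡⟨ cong (_% 3) (trans (regroup i b) (trans eq (swap k))) ⟩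
  (2 + k * 3) % 3         ≡⟨ [m+kn]%n≡m%n 2 k 3 ⟩
  2                       ∎
  where
  open ≡-Reasoning
  regroup : ∀ i b → i + b + 1 * 3 ≡ i + 3 + b
  regroup = ℕ-Solver.solve-∀
  swap : ∀ k → 3 * k + 2 ≡ 2 + k * 3
  swap = ℕ-Solver.solve-∀

proposition5 : (k : ℕ) → 1 ≤ k → (W : Word (3 * k + 2) 5) → InW2 W →
    (+ 4) / 3 Q.≤ excess W →
    ((i h′ : ℕ) → 1 ≤ h′ → h′ < 3 * k + 2 → (p : i + h′ ≤ 3 * k + 2) →
      excess (rows W i h′ p) Q.≤ emax h′ 5) →
    ¬ (Σ ℕ λ i → Σ (i + 3 ≤ 3 * k + 2) λ p → excess (rows W i 3 p) ≡ -[1+ 1 ] / 1)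
proposition5 k _ W W∈𝒲² heavy bounded (i , p , deficient) =
  Counting.no-deficient-block W W∈𝒲² (window-bounds W bounded) (thirds-word≥ W (+ 4) heavy)
    i b eq (residue-of-split i b k eq) (thirds-rows≤ W i 3 p -[1+ 5 ] (QP.≤-reflexive deficient))
  where
  b = proj₁ (ℕP.m≤n⇒∃[o]m+o≡n p)
  eq = proj₂ (ℕP.m≤n⇒∃[o]m+o≡n p)
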